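{- Let $n$ be a positive integer and let $A\in\{0,1\}^{n\times n}$ have at most $2n$ non-zero entries. Then $|\det(A)|\leq 2^{n/6}\cdot 3^{n/6}$. -}

module Defs where

open import Data.Nat using (ℕ; zero; suc)
import Data.Nat as ℕ
open import Data.Integer using (ℤ; +_; _*_; _+_; -_)
open import Data.Fin using (Fin; zero; suc; toℕ; punchIn)
open import Data.Bool using (Bool; true; false; if_then_else_)

sumℕ : ∀ n → (Fin n → ℕ) → ℕ
sumℕ zero    f = 0
sumℕ (suc n) f = f zero ℕ.+ sumℕ n (λ i → f (suc i))

sumℤ : ∀ n → (Fin n → ℤ) → ℤ
sumℤ zero    f = + 0
sumℤ (suc n) f = f zero + sumℤ n (λ i → f (suc i))

signℤ : ℕ → ℤ
signℤ zero    = + 1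
signℤ (suc k) = - signℤ k

Matrix : Set → ℕ → Set
Matrix A n = Fin n → Fin n → A

minor : ∀ {n} → Matrix ℤ (suc n) → Fin (suc n) → Matrix ℤ n
minor M j r c = M (suc r) (punchIn j c)

det : ∀ n → Matrix ℤ n → ℤ
det zero    M = + 1
det (suc n) M = sumℤ (suc n) (λ j → signℤ (toℕ j) * (M zero j * det n (minor M j)))

toℤMatrix : ∀ {n} → Matrix Bool n → Matrix ℤ n
toℤMatrix A i j = if A i j then + 1 else + 0

nonZeros : ∀ {n} → Matrix Bool n → ℕ
nonZeros {n} A = sumℕ n (λ i → sumℕ n (λ j → if A i j then 1 else 0))

-- Write z(M) for the number of ones of a 0/1 matrix M of size n. We prove
-- |det M|^6 · 6^n ≤ 6^z(M) by strong induction on n; for z(M) ≤ 2n this is the theorem.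
-- Expanding along a row i, |det M| is at most the sum of |det| over the minors at the ones
-- (i, j) of that row, and such a minor has rowDeg i + colDeg j - 1 fewer ones, so by
-- induction it carries an extra factor 6^(rowDeg i + colDeg j - 2).
-- If some row or column has at most one one, or every column has at least three, bounding
-- the sum by rowDeg i times its largest term suffices, because r^6 ≤ 6^(r+1).
-- Otherwise, up to transposition, some row has exactly two ones and every line has at least
-- two. Both minors then carry 6^2, and as 6^(-1/3) + 6^(-1/2) < 1 it suffices that one of
-- them carry 6^3. That fails only if both columns have two ones; then in the minor at the
-- first one, the second column has a single one, whose row either has another one (a further
-- factor 6) or is, in M, a copy of the expanded row, so that det M = 0.
module Submission where

open import Defs
open import Data.Nat using (ℕ; zero; suc)
open import Data.Fin using (Fin; zero; suc; toℕ; punchIn; punchOut)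
open import Data.Fin.Properties using (punchIn-punchOut; punchOut-injective; punchInᵢ≢i; any?) renaming (_≟_ to _≟ᶠ_)
open import Data.Product using (∃; _×_; _,_; proj₁; proj₂)
open import Data.Vec.Functional using (removeAt)
open import Relation.Binary.PropositionalEquality
open import Relation.Nullary using (contradiction)
open import Function using (_∘_)
import Algebra.Properties.Semiring.Sum as Sum
import Data.Nat.Properties as ℕP
import Data.Integer.Properties as ℤP

module ℕ∑ = Sum ℕP.+-*-semiring
module ℤ∑ = Sum ℤP.+-*-semiring

minorAt : ∀ {A : Set} {n} → Fin (suc n) → Fin (suc n) → Matrix A (suc n) → Matrix A n
minorAt i j M r c = M (punchIn i r) (punchIn j c)

transpose : ∀ {A : Set} {n} → Matrix A n → Matrix A n
transpose M i j = M j i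

module Determinant where

  import Data.Nat as ℕ
  open import Data.Integer using (ℤ; +_; -_; _+_; _*_; _-_; ∣_∣)
  open import Data.Integer.Tactic.RingSolver using (solve-∀)
  open import Algebra.Properties.AbelianGroup ℤP.+-0-abelianGroup using (∙-cancelˡ)
  open ℤ∑
  open ≡-Reasoning

  signℤ-+ : ∀ m n → signℤ (m ℕ.+ n) ≡ signℤ m * signℤ n
  signℤ-+ zero    n = sym (ℤP.*-identityˡ (signℤ n))
  signℤ-+ (suc m) n = trans (cong -_ (signℤ-+ m n)) (ℤP.neg-distribˡ-* (signℤ m) (signℤ n))

  ∣signℤ∣≡1 : ∀ n → ∣ signℤ n ∣ ≡ 1
  ∣signℤ∣≡1 zero    = refl
  ∣signℤ∣≡1 (suc n) = trans (ℤP.∣-i∣≡∣i∣ (signℤ n)) (∣signℤ∣≡1 n)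

  sumℤ≡sum : ∀ n (f : Fin n → ℤ) → sumℤ n f ≡ sum f
  sumℤ≡sum zero    f = refl
  sumℤ≡sum (suc n) f = cong (_+_ (f zero)) (sumℤ≡sum n (λ i → f (suc i)))

  *-*-distribˡ-sum : ∀ {n} a b (f : Fin n → ℤ) → a * (b * sum f) ≡ ∑[ i < n ] (a * (b * f i))
  *-*-distribˡ-sum a b f = trans (cong (a *_) (*-distribˡ-sum b f)) (*-distribˡ-sum a (λ i → b * f i))

  cofactorTerm : ∀ {n} → Matrix ℤ (suc n) → Fin (suc n) → Fin (suc n) → ℤ
  cofactorTerm {n} M i j = signℤ (toℕ i ℕ.+ toℕ j) * (M i j * det n (minorAt i j M))

  det-expand-row₀ : ∀ {n} (M : Matrix ℤ (suc n)) → det (suc n) M ≡ sum (cofactorTerm M zero)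
  det-expand-row₀ {n} M = sumℤ≡sum (suc n) (cofactorTerm M zero)

  det-cong : ∀ n {M N : Matrix ℤ n} → (∀ r c → M r c ≡ N r c) → det n M ≡ det n N
  det-cong zero    M≐N = refl
  det-cong (suc n) {M} {N} M≐N = begin
    det (suc n) M             ≡⟨ det-expand-row₀ M ⟩
    sum (cofactorTerm M zero) ≡⟨ sum-cong-≗ (λ j → cong₂ (λ m d → signℤ (toℕ j) * (m * d))
                                   (M≐N zero j) (det-cong n (λ r c → M≐N (suc r) (punchIn j c)))) ⟩
    sum (cofactorTerm N zero) ≡⟨ det-expand-row₀ N ⟨
    det (suc n) N             ∎

  -- Both sides sum F over the pairs (j, b) with j ≢ b.
  ∑-offDiagonal : ∀ {n} (F : Fin (suc n) → Fin (suc n) → ℤ) →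
    ∑[ j < suc n ] ∑[ k < n ] F j (punchIn j k) ≡ ∑[ c < suc n ] ∑[ l < n ] F (punchIn c l) c
  ∑-offDiagonal {n} F = ∙-cancelˡ (∑[ j < suc n ] F j j) _ _ (begin
    ∑[ j < suc n ] F j j + ∑[ j < suc n ] ∑[ k < n ] F j (punchIn j k)
      ≡⟨ ∑-distrib-+ (λ j → F j j) (λ j → ∑[ k < n ] F j (punchIn j k)) ⟨
    ∑[ j < suc n ] (F j j + ∑[ k < n ] F j (punchIn j k))
      ≡⟨ sum-cong-≗ (λ j → sum-remove {i = j} (F j)) ⟨
    ∑[ j < suc n ] ∑[ b < suc n ] F j b
      ≡⟨ ∑-comm F ⟩
    ∑[ c < suc n ] ∑[ a < suc n ] F a c
      ≡⟨ sum-cong-≗ (λ c → sum-remove {i = c} (λ a → F a c)) ⟩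
    ∑[ c < suc n ] (F c c + ∑[ l < n ] F (punchIn c l) c)
      ≡⟨ ∑-distrib-+ (λ c → F c c) (λ c → ∑[ l < n ] F (punchIn c l) c) ⟩
    ∑[ c < suc n ] F c c + ∑[ c < suc n ] ∑[ l < n ] F (punchIn c l) c ∎)

  -- punchOut without the proof of j ≢ b; its value at b = j is junk.
  punchOut′ : ∀ {n} → Fin (suc (suc n)) → Fin (suc (suc n)) → Fin (suc n)
  punchOut′         zero    zero    = zero
  punchOut′         zero    (suc b) = b
  punchOut′         (suc j) zero    = zero
  punchOut′ {zero}  (suc j) (suc b) = zero
  punchOut′ {suc n} (suc j) (suc b) = suc (punchOut′ j b)

  punchOut′-punchIn : ∀ {n} (j : Fin (suc (suc n))) k → punchOut′ j (punchIn j k) ≡ k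
  punchOut′-punchIn         zero    k       = refl
  punchOut′-punchIn         (suc j) zero    = refl
  punchOut′-punchIn {suc n} (suc j) (suc k) = cong suc (punchOut′-punchIn j k)

  punchIn-punchIn-swap : ∀ {n} (c : Fin (suc (suc n))) l x →
    punchIn (punchIn c l) (punchIn (punchOut′ (punchIn c l) c) x) ≡ punchIn c (punchIn l x)
  punchIn-punchIn-swap         zero    l       x       = refl
  punchIn-punchIn-swap         (suc c) zero    x       = refl
  punchIn-punchIn-swap {suc n} (suc c) (suc l) zero    = refl
  punchIn-punchIn-swap {suc n} (suc c) (suc l) (suc x) = cong suc (punchIn-punchIn-swap c l x)

  -- toℕ (punchIn c l) + toℕ (punchOut′ (punchIn c l) c) is toℕ c + toℕ l ± 1.
  signℤ-punchIn-swap : ∀ {n} (c : Fin (suc (suc n))) l →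
    signℤ (toℕ (punchIn c l)) * signℤ (toℕ (punchOut′ (punchIn c l) c)) ≡ - (signℤ (toℕ c) * signℤ (toℕ l))
  signℤ-punchIn-swap zero l = first-before (signℤ (toℕ l))
    where
    first-before : ∀ x → - x * + 1 ≡ - (+ 1 * x)
    first-before = solve-∀
  signℤ-punchIn-swap (suc c) zero = first-after (signℤ (toℕ c))
    where
    first-after : ∀ x → + 1 * x ≡ - (- x * + 1)
    first-after = solve-∀
  signℤ-punchIn-swap {suc n} (suc c) (suc l) =
    trans (neg-neg (signℤ (toℕ (punchIn c l))) (signℤ (toℕ (punchOut′ (punchIn c l) c))))
      (trans (signℤ-punchIn-swap c l) (cong -_ (sym (neg-neg (signℤ (toℕ c)) (signℤ (toℕ l))))))
    where
    neg-neg : ∀ x y → - x * - y ≡ x * y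
    neg-neg = solve-∀

  -- F j b is the term of the expansion of det M along rows 0 and suc i that takes column j
  -- from row 0 and column b from row suc i; D j b is the complementary minor.
  module DoubleExpansion {n} (M : Matrix ℤ (suc (suc n))) (i : Fin (suc n)) where

    D : Fin (suc (suc n)) → Fin (suc (suc n)) → ℤ
    D j b = det n (λ r x → M (suc (punchIn i r)) (punchIn j (punchIn (punchOut′ j b) x)))

    F : Fin (suc (suc n)) → Fin (suc (suc n)) → ℤ
    F j b = signℤ (toℕ j) * signℤ (toℕ i ℕ.+ toℕ (punchOut′ j b)) * (M zero j * M (suc i) b * D j b)

    row₀-then-row-i : (∀ N → det (suc n) N ≡ sum (cofactorTerm N i)) →
      ∀ j → cofactorTerm M zero j ≡ ∑[ k < suc n ] F j (punchIn j k)
    row₀-then-row-i expand-row-i j = begin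
      signℤ (toℕ j) * (M zero j * det (suc n) (minorAt zero j M))
        ≡⟨ cong (λ d → signℤ (toℕ j) * (M zero j * d)) (expand-row-i (minorAt zero j M)) ⟩
      signℤ (toℕ j) * (M zero j * sum (cofactorTerm (minorAt zero j M) i))
        ≡⟨ *-*-distribˡ-sum (signℤ (toℕ j)) (M zero j) (cofactorTerm (minorAt zero j M) i) ⟩
      ∑[ k < suc n ] (signℤ (toℕ j) * (M zero j * cofactorTerm (minorAt zero j M) i k))
        ≡⟨ sum-cong-≗ term ⟩
      ∑[ k < suc n ] F j (punchIn j k) ∎
      where
      rearrange : ∀ a b c d e → a * (b * (c * (d * e))) ≡ a * c * (b * d * e)
      rearrange = solve-∀
      term : ∀ k → signℤ (toℕ j) * (M zero j * cofactorTerm (minorAt zero j M) i k) ≡ F j (punchIn j k)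
      term k rewrite punchOut′-punchIn j k = rearrange (signℤ (toℕ j)) (M zero j) (signℤ (toℕ i ℕ.+ toℕ k))
        (M (suc i) (punchIn j k)) (det n (minorAt i k (minorAt zero j M)))

    row-i-then-row₀ : ∀ c → cofactorTerm M (suc i) c ≡ ∑[ l < suc n ] F (punchIn c l) c
    row-i-then-row₀ c = begin
      - sᵢc * (M (suc i) c * det (suc n) (minorAt (suc i) c M))
        ≡⟨ cong (λ d → - sᵢc * (M (suc i) c * d)) (det-expand-row₀ (minorAt (suc i) c M)) ⟩
      - sᵢc * (M (suc i) c * sum (cofactorTerm (minorAt (suc i) c M) zero))
        ≡⟨ *-*-distribˡ-sum (- sᵢc) (M (suc i) c) (cofactorTerm (minorAt (suc i) c M) zero) ⟩
      ∑[ l < suc n ] (- sᵢc * (M (suc i) c * cofactorTerm (minorAt (suc i) c M) zero l))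
        ≡⟨ sum-cong-≗ term ⟨
      ∑[ l < suc n ] F (punchIn c l) c ∎
      where
      sᵢc = signℤ (toℕ i ℕ.+ toℕ c)
      regroup : ∀ a b c d e f → a * (b * c) * (d * e * f) ≡ b * (a * c) * (d * e * f)
      regroup = solve-∀
      rearrange : ∀ si sc sl a b d → si * - (sc * sl) * (a * b * d) ≡ - (si * sc) * (b * (sl * (a * d)))
      rearrange = solve-∀
      term : ∀ l → F (punchIn c l) c ≡ - sᵢc * (M (suc i) c * cofactorTerm (minorAt (suc i) c M) zero l)
      term l = begin
        sⱼ * signℤ (toℕ i ℕ.+ toℕ (punchOut′ j c)) * (M zero j * M (suc i) c * D j c)
          ≡⟨ cong₂ (λ s d → sⱼ * s * (M zero j * M (suc i) c * d)) (signℤ-+ (toℕ i) (toℕ (punchOut′ j c)))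
               (det-cong n (λ r x → cong (M (suc (punchIn i r))) (punchIn-punchIn-swap c l x))) ⟩
        sⱼ * (sᵢ * sₚ) * (M zero j * M (suc i) c * D′)
          ≡⟨ regroup sⱼ sᵢ sₚ (M zero j) (M (suc i) c) D′ ⟩
        sᵢ * (sⱼ * sₚ) * (M zero j * M (suc i) c * D′)
          ≡⟨ cong (λ s → sᵢ * s * (M zero j * M (suc i) c * D′)) (signℤ-punchIn-swap c l) ⟩
        sᵢ * - (signℤ (toℕ c) * signℤ (toℕ l)) * (M zero j * M (suc i) c * D′)
          ≡⟨ rearrange sᵢ (signℤ (toℕ c)) (signℤ (toℕ l)) (M zero j) (M (suc i) c) D′ ⟩
        - (sᵢ * signℤ (toℕ c)) * (M (suc i) c * (signℤ (toℕ l) * (M zero j * D′)))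
          ≡⟨ cong (λ s → - s * (M (suc i) c * (signℤ (toℕ l) * (M zero j * D′)))) (signℤ-+ (toℕ i) (toℕ c)) ⟨
        - sᵢc * (M (suc i) c * cofactorTerm (minorAt (suc i) c M) zero l) ∎
        where
        j = punchIn c l
        sⱼ = signℤ (toℕ j)
        sᵢ = signℤ (toℕ i)
        sₚ = signℤ (toℕ (punchOut′ j c))
        D′ = det n (λ r x → M (suc (punchIn i r)) (punchIn c (punchIn l x)))

  det-expand-row : ∀ n (M : Matrix ℤ (suc n)) i → det (suc n) M ≡ sum (cofactorTerm M i)
  det-expand-row n       M zero    = det-expand-row₀ M
  det-expand-row (suc n) M (suc i) = begin
    det (suc (suc n)) M                                     ≡⟨ det-expand-row₀ M ⟩
    ∑[ j < suc (suc n) ] cofactorTerm M zero j              ≡⟨ sum-cong-≗ (row₀-then-row-i (λ N → det-expand-row n N i)) ⟩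
    ∑[ j < suc (suc n) ] ∑[ k < suc n ] F j (punchIn j k)   ≡⟨ ∑-offDiagonal F ⟩
    ∑[ c < suc (suc n) ] ∑[ l < suc n ] F (punchIn c l) c   ≡⟨ sum-cong-≗ row-i-then-row₀ ⟨
    ∑[ c < suc (suc n) ] cofactorTerm M (suc i) c           ∎
    where open DoubleExpansion M i

  det-expand-col₀ : ∀ n (M : Matrix ℤ (suc n)) →
    det (suc n) M ≡ ∑[ r < suc n ] (signℤ (toℕ r) * (M r zero * det n (minorAt r zero M)))
  det-expand-col₀ zero    M = det-expand-row₀ M
  det-expand-col₀ (suc n) M = trans (det-expand-row₀ M) (cong (_+_ (cofactorTerm M zero zero)) (begin
    ∑[ j < suc n ] (- sgn j * (M zero (suc j) * det (suc n) (minorAt zero (suc j) M)))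
      ≡⟨ sum-cong-≗ (λ j → cong (λ d → - sgn j * (M zero (suc j) * d)) (det-expand-col₀ n (minorAt zero (suc j) M))) ⟩
    ∑[ j < suc n ] (- sgn j * (M zero (suc j) * ∑[ i < suc n ] (sgn i * (M (suc i) zero * D i j))))
      ≡⟨ sum-cong-≗ (λ j → *-*-distribˡ-sum (- sgn j) (M zero (suc j)) (λ i → sgn i * (M (suc i) zero * D i j))) ⟩
    ∑[ j < suc n ] ∑[ i < suc n ] (- sgn j * (M zero (suc j) * (sgn i * (M (suc i) zero * D i j))))
      ≡⟨ ∑-comm (λ j i → - sgn j * (M zero (suc j) * (sgn i * (M (suc i) zero * D i j)))) ⟩
    ∑[ i < suc n ] ∑[ j < suc n ] (- sgn j * (M zero (suc j) * (sgn i * (M (suc i) zero * D i j))))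
      ≡⟨ sum-cong-≗ (λ i → sum-cong-≗ (λ j → swap (sgn j) (M zero (suc j)) (sgn i) (M (suc i) zero) (D i j))) ⟩
    ∑[ i < suc n ] ∑[ j < suc n ] (- sgn i * (M (suc i) zero * (sgn j * (M zero (suc j) * D i j))))
      ≡⟨ sum-cong-≗ (λ i → *-*-distribˡ-sum (- sgn i) (M (suc i) zero) (λ j → sgn j * (M zero (suc j) * D i j))) ⟨
    ∑[ i < suc n ] (- sgn i * (M (suc i) zero * ∑[ j < suc n ] (sgn j * (M zero (suc j) * D i j))))
      ≡⟨ sum-cong-≗ (λ i → cong (λ d → - sgn i * (M (suc i) zero * d)) (det-expand-row₀ (minorAt (suc i) zero M))) ⟨
    ∑[ i < suc n ] (- sgn i * (M (suc i) zero * det (suc n) (minorAt (suc i) zero M))) ∎))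
    where
    sgn : Fin (suc n) → ℤ
    sgn j = signℤ (toℕ j)
    D : Fin (suc n) → Fin (suc n) → ℤ
    D i j = det n (λ r x → M (suc (punchIn i r)) (suc (punchIn j x)))
    swap : ∀ sj a si b d → - sj * (a * (si * (b * d))) ≡ - si * (b * (sj * (a * d)))
    swap = solve-∀

  det-transpose : ∀ n (M : Matrix ℤ n) → det n (transpose M) ≡ det n M
  det-transpose zero    M = refl
  det-transpose (suc n) M = begin
    det (suc n) (transpose M)
      ≡⟨ det-expand-row₀ (transpose M) ⟩
    ∑[ j < suc n ] (signℤ (toℕ j) * (M j zero * det n (transpose (minorAt j zero M))))
      ≡⟨ sum-cong-≗ (λ j → cong (λ d → signℤ (toℕ j) * (M j zero * d)) (det-transpose n (minorAt j zero M))) ⟩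
    ∑[ j < suc n ] (signℤ (toℕ j) * (M j zero * det n (minorAt j zero M)))
      ≡⟨ det-expand-col₀ n M ⟨
    det (suc n) M ∎

  det-2×2 : (M : Matrix ℤ 2) → det 2 M ≡ M zero zero * M (suc zero) (suc zero) - M zero (suc zero) * M (suc zero) zero
  det-2×2 M = expand (M zero zero) (M zero (suc zero)) (M (suc zero) zero) (M (suc zero) (suc zero))
    where
    -- the left-hand side is det 2 M unfolded
    expand : ∀ a b c d → + 1 * (a * (+ 1 * (d * + 1) + + 0)) + (- + 1 * (b * (+ 1 * (c * + 1) + + 0)) + + 0) ≡ a * d - b * c
    expand = solve-∀

  det-2×2-equal-rows : (M : Matrix ℤ 2) → (∀ c → M zero c ≡ M (suc zero) c) → det 2 M ≡ + 0
  det-2×2-equal-rows M M₀≗M₁ = begin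
    det 2 M                                ≡⟨ det-2×2 M ⟩
    a * M (suc zero) (suc zero) - b * M (suc zero) zero
      ≡⟨ cong₂ (λ d c → a * d - b * c) (M₀≗M₁ (suc zero)) (M₀≗M₁ zero) ⟨
    a * b - b * a                          ≡⟨ cancel a b ⟩
    + 0                                    ∎
    where
    a = M zero zero
    b = M zero (suc zero)
    cancel : ∀ a b → a * b - b * a ≡ + 0
    cancel = solve-∀

  ∃-≢₂ : ∀ {n} (i k : Fin (suc (suc (suc n)))) → ∃ λ t → t ≢ i × t ≢ k
  ∃-≢₂ (suc i)        (suc k)        = zero , (λ ()) , (λ ())
  ∃-≢₂ zero           zero           = suc zero , (λ ()) , (λ ())
  ∃-≢₂ zero           (suc zero)     = suc (suc zero) , (λ ()) , (λ ())
  ∃-≢₂ zero           (suc (suc k))  = suc zero , (λ ()) , (λ ())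
  ∃-≢₂ (suc zero)     zero           = suc (suc zero) , (λ ()) , (λ ())
  ∃-≢₂ (suc (suc i))  zero           = suc zero , (λ ()) , (λ ())

  det-minors-vanish : ∀ n (M : Matrix ℤ (suc n)) t → (∀ c → det n (minorAt t c M) ≡ + 0) → det (suc n) M ≡ + 0
  det-minors-vanish n M t minors≡0 = begin
    det (suc n) M              ≡⟨ det-expand-row n M t ⟩
    sum (cofactorTerm M t)     ≡⟨ sum-cong-≗ vanishing ⟩
    ∑[ _ < suc n ] (+ 0)       ≡⟨ sum-replicate-zero (suc n) ⟩
    + 0                        ∎
    where
    vanish : ∀ s m → s * (m * + 0) ≡ + 0
    vanish = solve-∀
    vanishing : ∀ c → cofactorTerm M t c ≡ + 0
    vanishing c rewrite minors≡0 c = vanish (signℤ (toℕ t ℕ.+ toℕ c)) (M t c)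

  minorAt-equal-rows : ∀ {A : Set} {n} (M : Matrix A (suc n)) {t i k} (t≢i : t ≢ i) (t≢k : t ≢ k) →
    (∀ c → M i c ≡ M k c) → ∀ c x → minorAt t c M (punchOut t≢i) x ≡ minorAt t c M (punchOut t≢k) x
  minorAt-equal-rows M t≢i t≢k Mᵢ≗Mₖ c x =
    trans (cong (λ r → M r (punchIn c x)) (punchIn-punchOut t≢i))
      (trans (Mᵢ≗Mₖ (punchIn c x)) (cong (λ r → M r (punchIn c x)) (sym (punchIn-punchOut t≢k))))

  det-equal-rows : ∀ n (M : Matrix ℤ n) {i k} → i ≢ k → (∀ c → M i c ≡ M k c) → det n M ≡ + 0
  det-equal-rows (suc zero) M {zero} {zero} i≢k _ = contradiction refl i≢k
  det-equal-rows (suc (suc zero)) M {zero} {zero} i≢k _ = contradiction refl i≢k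
  det-equal-rows (suc (suc zero)) M {suc zero} {suc zero} i≢k _ = contradiction refl i≢k
  det-equal-rows (suc (suc zero)) M {zero} {suc zero} _ M₀≗M₁ = det-2×2-equal-rows M M₀≗M₁
  det-equal-rows (suc (suc zero)) M {suc zero} {zero} _ M₁≗M₀ = det-2×2-equal-rows M (λ c → sym (M₁≗M₀ c))
  det-equal-rows (suc (suc (suc n))) M {i} {k} i≢k Mᵢ≗Mₖ =
    let t , t≢i , t≢k = ∃-≢₂ i k in
    det-minors-vanish (suc (suc n)) M t (λ c →
      det-equal-rows (suc (suc n)) (minorAt t c M) (i≢k ∘ punchOut-injective t≢i t≢k) (minorAt-equal-rows M t≢i t≢k Mᵢ≗Mₖ c))

  ∣sum∣≤∑∣∣ : ∀ {n} (f : Fin n → ℤ) → ∣ sum f ∣ ℕ.≤ ℕ∑.sum (λ i → ∣ f i ∣)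
  ∣sum∣≤∑∣∣ {zero}  f = ℕ.z≤n
  ∣sum∣≤∑∣∣ {suc n} f = ℕP.≤-trans (ℤP.∣i+j∣≤∣i∣+∣j∣ (f zero) (sum (f ∘ suc)))
                                    (ℕP.+-monoʳ-≤ ∣ f zero ∣ (∣sum∣≤∑∣∣ (f ∘ suc)))

  ∣cofactorTerm∣ : ∀ {n} (M : Matrix ℤ (suc n)) i j → ∣ cofactorTerm M i j ∣ ≡ ∣ M i j ∣ ℕ.* ∣ det n (minorAt i j M) ∣
  ∣cofactorTerm∣ {n} M i j = begin
    ∣ s * (M i j * d) ∣         ≡⟨ ℤP.abs-* s (M i j * d) ⟩
    ∣ s ∣ ℕ.* ∣ M i j * d ∣     ≡⟨ cong₂ ℕ._*_ (∣signℤ∣≡1 (toℕ i ℕ.+ toℕ j)) (ℤP.abs-* (M i j) d) ⟩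
    1 ℕ.* (∣ M i j ∣ ℕ.* ∣ d ∣) ≡⟨ ℕP.*-identityˡ _ ⟩
    ∣ M i j ∣ ℕ.* ∣ d ∣         ∎
    where
    s = signℤ (toℕ i ℕ.+ toℕ j)
    d = det n (minorAt i j M)

  ∣det∣≤∑ : ∀ n (M : Matrix ℤ (suc n)) i → ∣ det (suc n) M ∣ ℕ.≤ ℕ∑.sum (λ j → ∣ M i j ∣ ℕ.* ∣ det n (minorAt i j M) ∣)
  ∣det∣≤∑ n M i = subst (λ x → x ℕ.≤ ℕ∑.sum (λ j → ∣ M i j ∣ ℕ.* ∣ det n (minorAt i j M) ∣))
    (cong ∣_∣ (sym (det-expand-row n M i)))
    (ℕP.≤-trans (∣sum∣≤∑∣∣ (cofactorTerm M i)) (ℕP.≤-reflexive (ℕ∑.sum-cong-≗ (∣cofactorTerm∣ M i))))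

open Determinant
open import Data.Nat
open import Data.Nat.Properties
open import Data.Nat.Induction using (<-rec)
open import Data.Nat.Tactic.RingSolver using (solve-∀)
open import Data.Integer using (∣_∣)
import Data.Integer as ℤ
open import Data.Bool using (Bool; true; false; if_then_else_)
open import Data.Sum using (_⊎_; inj₁; inj₂; [_,_]′)
open import Relation.Nullary using (yes; no; ¬_; Dec)
open ℕ∑

-- Elementary inequalities

*-^-shift : ∀ k .{{_ : NonZero k}} P a b a′ b′ → P * k ^ a ≤ k ^ b → a′ + b ≤ a + b′ → P * k ^ a′ ≤ k ^ b′
*-^-shift k P a b a′ b′ h exps = *-cancelˡ-≤ (k ^ a) {{m^n≢0 k a}} (begin
  k ^ a * (P * k ^ a′) ≡⟨ rearrange (k ^ a) P (k ^ a′) ⟩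
  P * k ^ a * k ^ a′   ≤⟨ *-monoˡ-≤ (k ^ a′) h ⟩
  k ^ b * k ^ a′       ≡⟨ *-comm (k ^ b) (k ^ a′) ⟩
  k ^ a′ * k ^ b       ≡⟨ ^-distribˡ-+-* k a′ b ⟨
  k ^ (a′ + b)         ≤⟨ ^-monoʳ-≤ k exps ⟩
  k ^ (a + b′)         ≡⟨ ^-distribˡ-+-* k a b′ ⟩
  k ^ a * k ^ b′       ∎)
  where
  open ≤-Reasoning
  rearrange : ∀ x y z → x * (y * z) ≡ y * x * z
  rearrange = solve-∀

^-distribʳ-* : ∀ m n k → (m * n) ^ k ≡ m ^ k * n ^ k
^-distribʳ-* m n zero    = refl
^-distribʳ-* m n (suc k) = trans (cong (m * n *_) (^-distribʳ-* m n k)) (rearrange m n (m ^ k) (n ^ k))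
  where
  rearrange : ∀ a b c d → a * b * (c * d) ≡ a * c * (b * d)
  rearrange = solve-∀

^-ratio : ∀ k p .{{_ : NonZero p}} q m s x → p * s ≤ q * x → q ^ k ≤ p ^ k * m → s ^ k ≤ m * x ^ k
^-ratio k p q m s x ps≤qx q^k≤p^k*m = *-cancelˡ-≤ (p ^ k) {{m^n≢0 p k}} (begin
  p ^ k * s ^ k       ≡⟨ ^-distribʳ-* p s k ⟨
  (p * s) ^ k         ≤⟨ ^-monoˡ-≤ k ps≤qx ⟩
  (q * x) ^ k         ≡⟨ ^-distribʳ-* q x k ⟩
  q ^ k * x ^ k       ≤⟨ *-monoˡ-≤ (x ^ k) q^k≤p^k*m ⟩
  p ^ k * m * x ^ k   ≡⟨ *-assoc (p ^ k) m (x ^ k) ⟩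
  p ^ k * (m * x ^ k) ∎)
  where open ≤-Reasoning

n^6≤6^[1+n] : ∀ n → n ^ 6 ≤ 6 ^ suc n
n^6≤6^[1+n] 0 = z≤n
n^6≤6^[1+n] 1 = ≤ᵇ⇒≤ 1 36 _
n^6≤6^[1+n] 2 = ≤ᵇ⇒≤ 64 216 _
n^6≤6^[1+n] 3 = ≤ᵇ⇒≤ 729 1296 _
n^6≤6^[1+n] (suc (suc (suc (suc n)))) = from-4 n
  where
  from-4 : ∀ n → (4 + n) ^ 6 ≤ 6 ^ (5 + n)
  from-4 zero    = ≤ᵇ⇒≤ (4 ^ 6) (6 ^ 5) _
  from-4 (suc n) = begin
    (5 + n) ^ 6     ≤⟨ ^-ratio 6 4 5 6 (5 + n) (4 + n) 4*[5+n]≤5*[4+n] (≤ᵇ⇒≤ (5 ^ 6) (4 ^ 6 * 6) _) ⟩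
    6 * (4 + n) ^ 6 ≤⟨ *-monoʳ-≤ 6 (from-4 n) ⟩
    6 * 6 ^ (5 + n) ∎
    where
    open ≤-Reasoning
    4*[5+n]≤5*[4+n] : 4 * (5 + n) ≤ 5 * (4 + n)
    4*[5+n]≤5*[4+n] = begin
      4 * (5 + n) ≡⟨ *-distribˡ-+ 4 5 n ⟩
      20 + 4 * n  ≤⟨ +-monoʳ-≤ 20 (*-monoˡ-≤ n (n≤1+n 4)) ⟩
      20 + 5 * n  ≡⟨ *-distribˡ-+ 5 4 n ⟨
      5 * (4 + n) ∎

[x+y]^6-split : ∀ x y → (x + y) ^ 6 ≤ 36 * x ^ 6 ⊎ (x + y) ^ 6 ≤ 216 * y ^ 6
[x+y]^6-split x y with 5 * y ≤? 4 * x
... | yes 5y≤4x = inj₁ (^-ratio 6 5 9 36 (x + y) x (begin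
      5 * (x + y)   ≡⟨ *-distribˡ-+ 5 x y ⟩
      5 * x + 5 * y ≤⟨ +-monoʳ-≤ (5 * x) 5y≤4x ⟩
      5 * x + 4 * x ≡⟨ *-distribʳ-+ x 5 4 ⟨
      9 * x         ∎) (≤ᵇ⇒≤ (9 ^ 6) (5 ^ 6 * 36) _))
  where open ≤-Reasoning
... | no 5y≰4x = inj₂ (^-ratio 6 4 9 216 (x + y) y (begin
      4 * (x + y)   ≡⟨ *-distribˡ-+ 4 x y ⟩
      4 * x + 4 * y ≤⟨ +-monoˡ-≤ (4 * y) (<⇒≤ (≰⇒> 5y≰4x)) ⟩
      5 * y + 4 * y ≡⟨ *-distribʳ-+ y 5 4 ⟨
      9 * y         ∎) (≤ᵇ⇒≤ (9 ^ 6) (4 ^ 6 * 216) _))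
  where open ≤-Reasoning

sum-bound : ∀ x y e z → x ^ 6 * 6 ^ (e + 2) ≤ 6 ^ z → y ^ 6 * 6 ^ (e + 3) ≤ 6 ^ z → (x + y) ^ 6 * 6 ^ e ≤ 6 ^ z
sum-bound x y e z x-bound y-bound =
  [ (λ ≤36x⁶  → ≤-trans (*-monoˡ-≤ (6 ^ e) ≤36x⁶)  (subst (_≤ 6 ^ z) (absorb x 2) x-bound))
  , (λ ≤216y⁶ → ≤-trans (*-monoˡ-≤ (6 ^ e) ≤216y⁶) (subst (_≤ 6 ^ z) (absorb y 3) y-bound))
  ]′ ([x+y]^6-split x y)
  where
  absorb : ∀ w d → w ^ 6 * 6 ^ (e + d) ≡ 6 ^ d * w ^ 6 * 6 ^ e
  absorb w d = trans (cong (w ^ 6 *_) (trans (^-distribˡ-+-* 6 e d) (*-comm (6 ^ e) (6 ^ d)))) (rearrange (w ^ 6) (6 ^ d) (6 ^ e))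
    where
    rearrange : ∀ a b c → a * (b * c) ≡ b * a * c
    rearrange = solve-∀

-- Counting ones

𝟙 : Bool → ℕ
𝟙 b = if b then 1 else 0

count : ∀ {n} → (Fin n → Bool) → ℕ
count v = sum (λ j → 𝟙 (v j))

rowDeg : ∀ {n} → Matrix Bool n → Fin n → ℕ
rowDeg M i = count (M i)

colDeg : ∀ {n} → Matrix Bool n → Fin n → ℕ
colDeg M j = count (transpose M j)

supportSum : ∀ {n} → (Fin n → Bool) → (Fin n → ℕ) → ℕ
supportSum v g = sum (λ j → 𝟙 (v j) * g j)

count-removeAt : ∀ {n} (v : Fin (suc n) → Bool) i → count v ≡ 𝟙 (v i) + count (removeAt v i)
count-removeAt v i = sum-remove {i = i} (λ j → 𝟙 (v j))

count-removeAt-true : ∀ {n} (v : Fin (suc n) → Bool) {i} → v i ≡ true → count v ≡ suc (count (removeAt v i))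
count-removeAt-true v {i} vᵢ = trans (count-removeAt v i) (cong (λ b → 𝟙 b + count (removeAt v i)) vᵢ)

count≡0⇒false : ∀ {n} (v : Fin n → Bool) → count v ≡ 0 → ∀ j → v j ≡ false
count≡0⇒false {suc n} v count≡0 j with v j in vⱼ
... | false = refl
... | true  = contradiction (trans (sym (count-removeAt-true v vⱼ)) count≡0) λ ()

∃-true : ∀ {n k} (v : Fin n → Bool) → count v ≡ suc k → ∃ λ j → v j ≡ true
∃-true {suc n} v count≡1+k with v zero in v₀
... | true  = zero , v₀
... | false = let j , vⱼ = ∃-true (λ j → v (suc j)) count≡1+k in suc j , vⱼ

count-pos : ∀ {n} (v : Fin (suc n) → Bool) {j} → v j ≡ true → 1 ≤ count v
count-pos v vⱼ = subst (1 ≤_) (sym (count-removeAt-true v vⱼ)) (s≤s z≤n)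

two-ones : ∀ {n} (v : Fin (suc n) → Bool) → count v ≡ 2 → ∃ λ a → ∃ λ o → v a ≡ true × v (punchIn a o) ≡ true
two-ones v count≡2 =
  let a , vₐ = ∃-true v count≡2
      o , vₒ = ∃-true (removeAt v a) (suc-injective (trans (sym (count-removeAt-true v vₐ)) count≡2))
  in a , o , vₐ , vₒ

count-removeAt₂ : ∀ {n} (v : Fin (suc (suc n)) → Bool) {a o} → count v ≡ 2 →
  v a ≡ true → v (punchIn a o) ≡ true → count (removeAt (removeAt v a) o) ≡ 0
count-removeAt₂ v {a} {o} count≡2 vₐ vₒ =
  suc-injective (suc-injective (trans (sym (trans (count-removeAt-true v vₐ) (cong suc (count-removeAt-true (removeAt v a) vₒ)))) count≡2))

≗-removeAt : ∀ {A : Set} {n} (v w : Fin (suc n) → A) i → v i ≡ w i → (∀ j → removeAt v i j ≡ removeAt w i j) → ∀ j → v j ≡ w j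
≗-removeAt v w i vᵢ≡wᵢ rest j with i ≟ᶠ j
... | yes refl = vᵢ≡wᵢ
... | no i≢j   = subst (λ k → v k ≡ w k) (punchIn-punchOut i≢j) (rest (punchOut i≢j))

same-two-ones : ∀ {n} (v w : Fin (suc (suc n)) → Bool) {a o} → count v ≡ 2 → count w ≡ 2 →
  v a ≡ true → w a ≡ true → v (punchIn a o) ≡ true → w (punchIn a o) ≡ true → ∀ j → v j ≡ w j
same-two-ones v w {a} {o} cv cw vₐ wₐ vₒ wₒ =
  ≗-removeAt v w a (trans vₐ (sym wₐ)) (≗-removeAt (removeAt v a) (removeAt w a) o (trans vₒ (sym wₒ)) λ z →
    trans (count≡0⇒false _ (count-removeAt₂ v cv vₐ vₒ) z) (sym (count≡0⇒false _ (count-removeAt₂ w cw wₐ wₒ) z)))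

supportSum-removeAt : ∀ {n} (v : Fin (suc n) → Bool) g {i} → v i ≡ true →
  supportSum v g ≡ g i + supportSum (removeAt v i) (removeAt g i)
supportSum-removeAt v g {i} vᵢ = begin
  supportSum v g                                        ≡⟨ sum-remove {i = i} (λ j → 𝟙 (v j) * g j) ⟩
  𝟙 (v i) * g i + supportSum (removeAt v i) (removeAt g i) ≡⟨ cong (λ b → 𝟙 b * g i + supportSum (removeAt v i) (removeAt g i)) vᵢ ⟩
  1 * g i + supportSum (removeAt v i) (removeAt g i)     ≡⟨ cong (_+ supportSum (removeAt v i) (removeAt g i)) (*-identityˡ (g i)) ⟩
  g i + supportSum (removeAt v i) (removeAt g i)         ∎
  where open ≡-Reasoning

supportSum-count≡0 : ∀ {n} (v : Fin n → Bool) g → count v ≡ 0 → supportSum v g ≡ 0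
supportSum-count≡0 {n} v g count≡0 =
  trans (sum-cong-≗ (λ j → cong (λ b → 𝟙 b * g j) (count≡0⇒false v count≡0 j))) (sum-replicate-zero n)

sum-mono-≤ : ∀ {n} {f g : Fin n → ℕ} → (∀ i → f i ≤ g i) → sum f ≤ sum g
sum-mono-≤ {zero}  f≤g = z≤n
sum-mono-≤ {suc n} f≤g = +-mono-≤ (f≤g zero) (sum-mono-≤ (λ i → f≤g (suc i)))

supportSum-≤ : ∀ {n} (v : Fin n → Bool) g t → (∀ j → v j ≡ true → g j ≤ t) → supportSum v g ≤ count v * t
supportSum-≤ v g t g≤t = ≤-trans (sum-mono-≤ term-≤) (≤-reflexive (sym (*-distribʳ-sum t (λ j → 𝟙 (v j)))))
  where
  term-≤ : ∀ j → 𝟙 (v j) * g j ≤ 𝟙 (v j) * t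
  term-≤ j with v j in vⱼ
  ... | true  = *-monoʳ-≤ 1 (g≤t j vⱼ)
  ... | false = z≤n

sumℕ≡sum : ∀ n (f : Fin n → ℕ) → sumℕ n f ≡ sum f
sumℕ≡sum zero    f = refl
sumℕ≡sum (suc n) f = cong (f zero +_) (sumℕ≡sum n (λ i → f (suc i)))

nonZeros≡∑rowDeg : ∀ {n} (M : Matrix Bool n) → nonZeros M ≡ sum (rowDeg M)
nonZeros≡∑rowDeg {n} M = trans (sumℕ≡sum n _) (sum-cong-≗ (λ i → sumℕ≡sum n (λ j → 𝟙 (M i j))))

nonZeros-transpose : ∀ {n} (M : Matrix Bool n) → nonZeros (transpose M) ≡ nonZeros M
nonZeros-transpose M = trans (nonZeros≡∑rowDeg (transpose M))
  (trans (sym (∑-comm (λ i j → 𝟙 (M i j)))) (sym (nonZeros≡∑rowDeg M)))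

nonZeros-minorAt : ∀ {n} (M : Matrix Bool (suc n)) i j →
  nonZeros M + 𝟙 (M i j) ≡ rowDeg M i + colDeg M j + nonZeros (minorAt i j M)
nonZeros-minorAt M i j = begin
  nonZeros M + 𝟙 (M i j)
    ≡⟨ cong (_+ 𝟙 (M i j)) (trans (nonZeros≡∑rowDeg M) (sum-remove {i = i} (rowDeg M))) ⟩
  rowDeg M i + sum (λ r → rowDeg M (punchIn i r)) + 𝟙 (M i j)
    ≡⟨ cong (λ s → rowDeg M i + s + 𝟙 (M i j)) (trans (sum-cong-≗ (λ r → count-removeAt (M (punchIn i r)) j))
         (∑-distrib-+ (λ r → 𝟙 (M (punchIn i r) j)) (rowDeg (minorAt i j M)))) ⟩
  rowDeg M i + (colRest + sum (rowDeg (minorAt i j M))) + 𝟙 (M i j)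
    ≡⟨ rearrange (rowDeg M i) colRest (sum (rowDeg (minorAt i j M))) (𝟙 (M i j)) ⟩
  rowDeg M i + (𝟙 (M i j) + colRest) + sum (rowDeg (minorAt i j M))
    ≡⟨ cong₂ (λ c z → rowDeg M i + c + z) (sym (count-removeAt (transpose M j) i)) (sym (nonZeros≡∑rowDeg (minorAt i j M))) ⟩
  rowDeg M i + colDeg M j + nonZeros (minorAt i j M) ∎
  where
  open ≡-Reasoning
  colRest = sum (λ r → 𝟙 (M (punchIn i r) j))
  rearrange : ∀ r c z b → r + (c + z) + b ≡ r + (b + c) + z
  rearrange = solve-∀

supportSum-one : ∀ {n} (v : Fin (suc n) → Bool) g {a} → count v ≡ 1 → v a ≡ true → supportSum v g ≡ g a
supportSum-one v g {a} count≡1 vₐ = begin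
  supportSum v g                                       ≡⟨ supportSum-removeAt v g vₐ ⟩
  g a + supportSum (removeAt v a) (removeAt g a)       ≡⟨ cong (g a +_) (supportSum-count≡0 (removeAt v a) (removeAt g a) rest≡0) ⟩
  g a + 0                                              ≡⟨ +-identityʳ (g a) ⟩
  g a                                                  ∎
  where
  open ≡-Reasoning
  rest≡0 = suc-injective (trans (sym (count-removeAt-true v vₐ)) count≡1)

supportSum-two : ∀ {n} (v : Fin (suc (suc n)) → Bool) g {a o} → count v ≡ 2 → v a ≡ true → v (punchIn a o) ≡ true →
  supportSum v g ≡ g a + g (punchIn a o)
supportSum-two v g {a} {o} count≡2 vₐ vₒ = begin
  supportSum v g                                                       ≡⟨ supportSum-removeAt v g vₐ ⟩
  g a + supportSum (removeAt v a) (removeAt g a)                       ≡⟨ cong (g a +_) (supportSum-removeAt (removeAt v a) (removeAt g a) vₒ) ⟩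
  g a + (g (punchIn a o) + supportSum (removeAt (removeAt v a) o) (removeAt (removeAt g a) o))   ≡⟨ cong (λ s → g a + (g (punchIn a o) + s)) (supportSum-count≡0 (removeAt (removeAt v a) o) (removeAt (removeAt g a) o) (count-removeAt₂ v count≡2 vₐ vₒ)) ⟩
  g a + (g (punchIn a o) + 0)                                          ≡⟨ cong (g a +_) (+-identityʳ (g (punchIn a o))) ⟩
  g a + g (punchIn a o)                                                ∎
  where open ≡-Reasoning

supportMax : ∀ {n} → (Fin n → Bool) → (Fin n → ℕ) → ℕ
supportMax {zero}  v g = 0
supportMax {suc n} v g = (if v zero then g zero else 0) ⊔ supportMax (λ j → v (suc j)) (λ j → g (suc j))

≤-supportMax : ∀ {n} (v : Fin n → Bool) g {j} → v j ≡ true → g j ≤ supportMax v g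
≤-supportMax v g {zero}  v₀ rewrite v₀ = m≤m⊔n (g zero) _
≤-supportMax v g {suc j} vⱼ = ≤-trans (≤-supportMax (λ j → v (suc j)) (λ j → g (suc j)) vⱼ) (m≤n⊔m _ _)

supportMax-attained : ∀ {n} (v : Fin n → Bool) g → supportMax v g ≡ 0 ⊎ ∃ λ j → v j ≡ true × supportMax v g ≡ g j
supportMax-attained {zero}  v g = inj₁ refl
supportMax-attained {suc n} v g with ⊔-sel (if v zero then g zero else 0) (supportMax (λ j → v (suc j)) (λ j → g (suc j)))
                                   | supportMax-attained (λ j → v (suc j)) (λ j → g (suc j))
... | inj₁ max≡head | _ with v zero in v₀
...   | true  = inj₂ (zero , v₀ , max≡head)
...   | false = inj₁ max≡head
supportMax-attained v g | inj₂ max≡rest | inj₁ rest≡0 = inj₁ (trans max≡rest rest≡0)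
supportMax-attained v g | inj₂ max≡rest | inj₂ (j , vⱼ , rest≡gⱼ) = inj₂ (suc j , vⱼ , trans max≡rest rest≡gⱼ)

-- The induction

absDet : ∀ {n} → Matrix Bool n → ℕ
absDet {n} M = ∣ det n (toℤMatrix M) ∣

Bounded : ∀ {n} → Matrix Bool n → Set
Bounded {n} M = absDet M ^ 6 * 6 ^ n ≤ 6 ^ nonZeros M

AllBounded : ℕ → Set
AllBounded n = ∀ (M : Matrix Bool n) → Bounded M

∣toℤ∣≡𝟙 : ∀ b → ∣ (if b then ℤ.+ 1 else ℤ.+ 0) ∣ ≡ 𝟙 b
∣toℤ∣≡𝟙 true  = refl
∣toℤ∣≡𝟙 false = refl

absDet-transpose : ∀ {n} (M : Matrix Bool n) → absDet (transpose M) ≡ absDet M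
absDet-transpose {n} M = cong ∣_∣ (det-transpose n (toℤMatrix M))

absDet-equal-rows : ∀ {n} (M : Matrix Bool n) {i k} → i ≢ k → (∀ c → M i c ≡ M k c) → absDet M ≡ 0
absDet-equal-rows {n} M i≢k Mᵢ≗Mₖ =
  cong ∣_∣ (det-equal-rows n (toℤMatrix M) i≢k (λ c → cong (λ b → if b then ℤ.+ 1 else ℤ.+ 0) (Mᵢ≗Mₖ c)))

Bounded-transpose : ∀ {n} (M : Matrix Bool n) → Bounded (transpose M) → Bounded M
Bounded-transpose {n} M = subst₂ (λ x z → x ^ 6 * 6 ^ n ≤ 6 ^ z) (absDet-transpose M) (nonZeros-transpose M)

absDet-row : ∀ {n} (M : Matrix Bool (suc n)) i → absDet M ≤ supportSum (M i) (λ j → absDet (minorAt i j M))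
absDet-row {n} M i = ≤-trans (∣det∣≤∑ n (toℤMatrix M) i)
  (≤-reflexive (sum-cong-≗ (λ j → cong (_* absDet (minorAt i j M)) (∣toℤ∣≡𝟙 (M i j)))))

absDet-col : ∀ {n} (M : Matrix Bool (suc n)) j → absDet M ≤ supportSum (transpose M j) (λ i → absDet (minorAt i j M))
absDet-col M j = begin
  absDet M                                                                ≡⟨ absDet-transpose M ⟨
  absDet (transpose M)                                                    ≤⟨ absDet-row (transpose M) j ⟩
  supportSum (transpose M j) (λ i → absDet (transpose (minorAt i j M)))  ≡⟨ sum-cong-≗ (λ i → cong (𝟙 (M i j) *_) (absDet-transpose (minorAt i j M))) ⟩
  supportSum (transpose M j) (λ i → absDet (minorAt i j M))              ∎
  where open ≤-Reasoning

-- Deleting row i and column j through a one removes rowDeg M i + colDeg M j - 1 ones.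
minor-bound : ∀ {n} (M : Matrix Bool (suc n)) i j x a k → M i j ≡ true →
  x ^ 6 * 6 ^ a ≤ 6 ^ nonZeros (minorAt i j M) → k + 2 ≤ rowDeg M i + colDeg M j →
  x ^ 6 * 6 ^ (suc a + k) ≤ 6 ^ nonZeros M
minor-bound M i j x a k Mᵢⱼ x-bound degrees =
  *-^-shift 6 (x ^ 6) a z′ (suc a + k) (nonZeros M) x-bound (+-cancelʳ-≤ 1 (suc a + k + z′) (a + nonZeros M) (begin
    suc a + k + z′ + 1                  ≡⟨ rearrange a k z′ ⟩
    a + (k + 2 + z′)                    ≤⟨ +-monoʳ-≤ a (+-monoˡ-≤ z′ degrees) ⟩
    a + (rowDeg M i + colDeg M j + z′)  ≡⟨ cong (a +_) (nonZeros-minorAt M i j) ⟨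
    a + (nonZeros M + 𝟙 (M i j))        ≡⟨ cong (λ b → a + (nonZeros M + 𝟙 b)) Mᵢⱼ ⟩
    a + (nonZeros M + 1)                ≡⟨ +-assoc a (nonZeros M) 1 ⟨
    a + nonZeros M + 1                  ∎))
  where
  open ≤-Reasoning
  z′ = nonZeros (minorAt i j M)
  rearrange : ∀ a k z → 1 + a + k + z + 1 ≡ a + (k + 2 + z)
  rearrange = solve-∀

-- |det M| is at most rowDeg M i times the largest minor at a one of row i.
row-bound : ∀ {n} → AllBounded n → (M : Matrix Bool (suc n)) (i : Fin (suc n)) (k : ℕ) → rowDeg M i ^ 6 ≤ 6 ^ k →
  (∀ j → M i j ≡ true → k + 2 ≤ rowDeg M i + colDeg M j) → Bounded M
row-bound {n} IH M i k r⁶≤6ᵏ degrees = begin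
  absDet M ^ 6 * 6 ^ suc n      ≤⟨ *-monoˡ-≤ (6 ^ suc n) (^-monoˡ-≤ 6 absDet≤r*t) ⟩
  (r * t) ^ 6 * 6 ^ suc n       ≡⟨ cong (_* 6 ^ suc n) (^-distribʳ-* r t 6) ⟩
  r ^ 6 * t ^ 6 * 6 ^ suc n     ≡⟨ rearrange (r ^ 6) (t ^ 6) (6 ^ suc n) ⟩
  t ^ 6 * (r ^ 6 * 6 ^ suc n)   ≤⟨ *-monoʳ-≤ (t ^ 6) (*-monoˡ-≤ (6 ^ suc n) r⁶≤6ᵏ) ⟩
  t ^ 6 * (6 ^ k * 6 ^ suc n)   ≡⟨ cong (t ^ 6 *_) (trans (^-distribˡ-+-* 6 (suc n) k) (*-comm (6 ^ suc n) (6 ^ k))) ⟨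
  t ^ 6 * 6 ^ (suc n + k)       ≤⟨ t-bound ⟩
  6 ^ nonZeros M                ∎
  where
  open ≤-Reasoning
  r = rowDeg M i
  X : Fin (suc n) → ℕ
  X j = absDet (minorAt i j M)
  t = supportMax (M i) X
  absDet≤r*t : absDet M ≤ r * t
  absDet≤r*t = ≤-trans (absDet-row M i) (supportSum-≤ (M i) X t (λ j Mᵢⱼ → ≤-supportMax (M i) X Mᵢⱼ))
  rearrange : ∀ a b c → a * b * c ≡ b * (a * c)
  rearrange = solve-∀
  t-bound : t ^ 6 * 6 ^ (suc n + k) ≤ 6 ^ nonZeros M
  t-bound with supportMax-attained (M i) X
  ... | inj₁ t≡0 = subst (λ y → y ^ 6 * 6 ^ (suc n + k) ≤ 6 ^ nonZeros M) (sym t≡0) z≤n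
  ... | inj₂ (j , Mᵢⱼ , t≡Xⱼ) = subst (λ y → y ^ 6 * 6 ^ (suc n + k) ≤ 6 ^ nonZeros M) (sym t≡Xⱼ)
                                  (minor-bound M i j (X j) n k Mᵢⱼ (IH (minorAt i j M)) (degrees j Mᵢⱼ))

low-row-bound : ∀ {n} → AllBounded n → (M : Matrix Bool (suc n)) (i : Fin (suc n)) → rowDeg M i ≤ 1 → Bounded M
low-row-bound IH M i r≤1 = row-bound IH M i 0 (^-monoˡ-≤ 6 r≤1)
  (λ j Mᵢⱼ → +-mono-≤ (count-pos (M i) Mᵢⱼ) (count-pos (transpose M j) Mᵢⱼ))

high-column-bound : ∀ {n} → AllBounded n → (M : Matrix Bool (suc n)) → (∀ j → 3 ≤ colDeg M j) → Bounded M
high-column-bound IH M cols≥3 = row-bound IH M zero (suc r) (n^6≤6^[1+n] r)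
  (λ j _ → subst (_≤ r + colDeg M j) (+-suc r 2) (+-monoʳ-≤ r (cols≥3 j)))
  where r = rowDeg M zero

equal-rows-or-minor-bound : ∀ {m} → AllBounded m → (M : Matrix Bool (suc (suc m))) → (∀ i → 2 ≤ rowDeg M i) →
  ∀ u a o → rowDeg M u ≡ 2 → M u a ≡ true → M u (punchIn a o) ≡ true → 2 ≤ colDeg M a → colDeg M (punchIn a o) ≡ 2 →
  absDet M ≡ 0 ⊎ absDet (minorAt u a M) ^ 6 * 6 ^ (suc (suc m) + 3) ≤ 6 ^ nonZeros M
equal-rows-or-minor-bound {m} IH M rows≥2 u a o rᵤ≡2 Mᵤₐ Mᵤᵦ cₐ≥2 cᵦ≡2 = via-unique-one (∃-true (transpose D o) cᴰₒ≡1)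
  where
  D = minorAt u a M
  cᴰₒ≡1 : colDeg D o ≡ 1
  cᴰₒ≡1 = suc-injective (trans (sym (count-removeAt-true (transpose M (punchIn a o)) Mᵤᵦ)) cᵦ≡2)

  via-unique-one : (∃ λ w → D w o ≡ true) → absDet M ≡ 0 ⊎ absDet D ^ 6 * 6 ^ (suc (suc m) + 3) ≤ 6 ^ nonZeros M
  via-unique-one (w , Dwo) with 2 ≤? rowDeg D w
  ... | yes rᴰ≥2 = inj₂ (subst (λ e → absDet D ^ 6 * 6 ^ e ≤ 6 ^ nonZeros M) (exponent m) bound-in-M)
    where
    E = minorAt w o D
    absDetD≤absDetE : absDet D ≤ absDet E
    absDetD≤absDetE = ≤-trans (absDet-col D o) (≤-reflexive (supportSum-one (transpose D o) (λ i → absDet (minorAt i o D)) cᴰₒ≡1 Dwo))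
    bound-in-D : absDet D ^ 6 * 6 ^ (suc m + 1) ≤ 6 ^ nonZeros D
    bound-in-D = ≤-trans (*-monoˡ-≤ (6 ^ (suc m + 1)) (^-monoˡ-≤ 6 absDetD≤absDetE))
      (minor-bound D w o (absDet E) m 1 Dwo (IH E) (subst (λ c → 3 ≤ rowDeg D w + c) (sym cᴰₒ≡1) (+-monoˡ-≤ 1 rᴰ≥2)))
    bound-in-M : absDet D ^ 6 * 6 ^ (suc (suc m + 1) + 2) ≤ 6 ^ nonZeros M
    bound-in-M = minor-bound M u a (absDet D) (suc m + 1) 2 Mᵤₐ bound-in-D
      (subst (λ r → 4 ≤ r + colDeg M a) (sym rᵤ≡2) (+-monoʳ-≤ 2 cₐ≥2))
    exponent : ∀ m → 2 + m + 1 + 2 ≡ 2 + m + 3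
    exponent = solve-∀
  ... | no rᴰ≱2 = inj₁ (absDet-equal-rows M (λ u≡w′ → punchInᵢ≢i u w (sym u≡w′))
                         (same-two-ones (M u) (M w′) rᵤ≡2 rʷ′≡2 Mᵤₐ Mʷ′ₐ Mᵤᵦ Dwo))
    where
    w′ = punchIn u w
    forced : ∀ b k → 2 ≤ 𝟙 b + k → k ≤ 1 → b ≡ true × 𝟙 b + k ≡ 2
    forced true  k 2≤1+k k≤1 = refl , ≤-antisym (s≤s k≤1) 2≤1+k
    forced false k 2≤k   k≤1 = contradiction (≤-trans 2≤k k≤1) λ { (s≤s ()) }
    rʷ′-split : rowDeg M w′ ≡ 𝟙 (M w′ a) + rowDeg D w
    rʷ′-split = count-removeAt (M w′) a
    forced-w′ = forced (M w′ a) (rowDeg D w) (subst (2 ≤_) rʷ′-split (rows≥2 w′)) (≤-pred (≰⇒> rᴰ≱2))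
    Mʷ′ₐ = proj₁ forced-w′
    rʷ′≡2 = trans rʷ′-split (proj₂ forced-w′)

two-row-bound : ∀ {m} → AllBounded (suc m) → AllBounded m → (M : Matrix Bool (suc (suc m))) →
  (∀ i → 2 ≤ rowDeg M i) → (∀ j → 2 ≤ colDeg M j) → ∀ u → rowDeg M u ≡ 2 → Bounded M
two-row-bound {m} IH₁ IH₂ M rows≥2 cols≥2 u rᵤ≡2 = bound-with (two-ones (M u) rᵤ≡2)
  where
  X : Fin (suc (suc m)) → ℕ
  X j = absDet (minorAt u j M)

  weighted : ∀ j d → M u j ≡ true → d ≤ colDeg M j → X j ^ 6 * 6 ^ (suc (suc m) + d) ≤ 6 ^ nonZeros M
  weighted j d Mᵤⱼ d≤cⱼ = ≤-trans (*-monoʳ-≤ (X j ^ 6) (^-monoʳ-≤ 6 (+-monoʳ-≤ (suc (suc m)) d≤cⱼ)))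
    (minor-bound M u j (X j) (suc m) (colDeg M j) Mᵤⱼ (IH₁ (minorAt u j M))
      (subst (λ r → colDeg M j + 2 ≤ r + colDeg M j) (sym rᵤ≡2) (≤-reflexive (+-comm (colDeg M j) 2))))

  from-sum : ∀ x y → absDet M ≤ x + y → x ^ 6 * 6 ^ (suc (suc m) + 2) ≤ 6 ^ nonZeros M →
    y ^ 6 * 6 ^ (suc (suc m) + 3) ≤ 6 ^ nonZeros M → Bounded M
  from-sum x y absDet≤x+y x-bound y-bound =
    ≤-trans (*-monoˡ-≤ (6 ^ suc (suc m)) (^-monoˡ-≤ 6 absDet≤x+y)) (sum-bound x y (suc (suc m)) (nonZeros M) x-bound y-bound)

  bound-with : (∃ λ a → ∃ λ o → M u a ≡ true × M u (punchIn a o) ≡ true) → Bounded M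
  bound-with (a , o , Mᵤₐ , Mᵤᵦ) = cases (3 ≤? colDeg M a) (3 ≤? colDeg M b)
    where
    b = punchIn a o
    absDet≤a+b : absDet M ≤ X a + X b
    absDet≤a+b = ≤-trans (absDet-row M u) (≤-reflexive (supportSum-two (M u) X rᵤ≡2 Mᵤₐ Mᵤᵦ))
    absDet≤b+a : absDet M ≤ X b + X a
    absDet≤b+a = ≤-trans absDet≤a+b (≤-reflexive (+-comm (X a) (X b)))
    cases : Dec (3 ≤ colDeg M a) → Dec (3 ≤ colDeg M b) → Bounded M
    cases (yes cₐ≥3) _         = from-sum (X b) (X a) absDet≤b+a (weighted b 2 Mᵤᵦ (cols≥2 b)) (weighted a 3 Mᵤₐ cₐ≥3)
    cases (no _)     (yes cᵦ≥3) = from-sum (X a) (X b) absDet≤a+b (weighted a 2 Mᵤₐ (cols≥2 a)) (weighted b 3 Mᵤᵦ cᵦ≥3)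
    cases (no _)     (no cᵦ≱3)  =
      [ (λ absDet≡0 → subst (λ x → x ^ 6 * 6 ^ suc (suc m) ≤ 6 ^ nonZeros M) (sym absDet≡0) z≤n)
      , from-sum (X b) (X a) absDet≤b+a (weighted b 2 Mᵤᵦ (cols≥2 b))
      ]′ (equal-rows-or-minor-bound IH₂ M rows≥2 u a o rᵤ≡2 Mᵤₐ Mᵤᵦ (cols≥2 a) (≤-antisym (≤-pred (≰⇒> cᵦ≱3)) (cols≥2 b)))

¬∃≤1⇒≥2 : ∀ {n} {f : Fin n → ℕ} → ¬ (∃ λ i → f i ≤ 1) → ∀ i → 2 ≤ f i
¬∃≤1⇒≥2 ¬low i = ≰⇒> (λ fᵢ≤1 → ¬low (i , fᵢ≤1))

bounded-step : ∀ {m} → AllBounded (suc m) → AllBounded m → AllBounded (suc (suc m))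
bounded-step IH₁ IH₂ M with any? (λ i → rowDeg M i ≤? 1) | any? (λ j → colDeg M j ≤? 1)
... | yes (i , rᵢ≤1) | _ = low-row-bound IH₁ M i rᵢ≤1
... | no _ | yes (j , cⱼ≤1) = Bounded-transpose M (low-row-bound IH₁ (transpose M) j cⱼ≤1)
... | no ¬low-row | no ¬low-col with any? (λ i → rowDeg M i ≟ 2) | any? (λ j → colDeg M j ≟ 2)
...   | yes (u , rᵤ≡2) | _ = two-row-bound IH₁ IH₂ M (¬∃≤1⇒≥2 ¬low-row) (¬∃≤1⇒≥2 ¬low-col) u rᵤ≡2
...   | no _ | yes (v , cᵥ≡2) =
  Bounded-transpose M (two-row-bound IH₁ IH₂ (transpose M) (¬∃≤1⇒≥2 ¬low-col) (¬∃≤1⇒≥2 ¬low-row) v cᵥ≡2)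
...   | no _ | no ¬col≡2 =
  high-column-bound IH₁ M (λ j → ≤∧≢⇒< (¬∃≤1⇒≥2 ¬low-col j) (λ 2≡cⱼ → ¬col≡2 (j , sym 2≡cⱼ)))

all-bounded : ∀ n → AllBounded n
all-bounded = <-rec AllBounded step
  where
  single-entry : ∀ b → 𝟙 b + 0 ≤ 1
  single-entry true  = ≤-refl
  single-entry false = z≤n
  step : ∀ n → (∀ {m} → m < n → AllBounded m) → AllBounded n
  step zero           _  M = ≤-refl
  step (suc zero)     IH M = low-row-bound (IH ≤-refl) M zero (single-entry (M zero zero))
  step (suc (suc m))  IH   = bounded-step (IH ≤-refl) (IH (m<n⇒m<1+n (n<1+n m)))

theorem3 : (n : ℕ) → 1 ≤ n → (A : Matrix Bool n) → nonZeros A ≤ 2 * n →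
    ∣ det n (toℤMatrix A) ∣ ^ 6 ≤ 6 ^ n
theorem3 n _ A nonZeros≤2n = *-cancelʳ-≤ (absDet A ^ 6) (6 ^ n) (6 ^ n) {{m^n≢0 6 n}} (begin
  absDet A ^ 6 * 6 ^ n  ≤⟨ all-bounded n A ⟩
  6 ^ nonZeros A        ≤⟨ ^-monoʳ-≤ 6 nonZeros≤2n ⟩
  6 ^ (2 * n)           ≡⟨ cong (λ e → 6 ^ (n + e)) (+-identityʳ n) ⟩
  6 ^ (n + n)           ≡⟨ ^-distribˡ-+-* 6 n n ⟩
  6 ^ n * 6 ^ n         ∎)
  where open ≤-Reasoning
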